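{- $\mathcal{H}$ is an ideal on $\omega$.
   Context: Fix a family $\{A_s\subseteq\omega: s\in\omega^{<\omega}\}$ such that $A_\emptyset=\omega$, every $A_s$ is infinite, $\{A_{s^\frown n}:n\in\omega\}$ is a partition of $A_s$, and for distinct $n,m\in\omega$ there exist $s\neq t$ in $\omega^{<\omega}$ with $n\in A_s$, $m\in A_t$. A set $A\subseteq\omega$ is big' if $A$ is infinite and for every $s\in\omega^{<\omega}$, if $|A\cap A_s|=\omega$ then there are infinitely many $n$ with $|A\cap A_{s^\frown n}|=\omega$. A set is big if it contains a big' set. $\mathcal{H}=\mathcal{P}(\omega)\setminus\{A\subseteq\omega: A\text{ is big}\}$. -}

module Defs where

open import Level using (Level; 0ℓ) renaming (suc to lsuc)
open import Data.Nat using (ℕ; _≤_; _<_)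
open import Data.List using (List; []; _∷_; _++_; [_])
open import Data.Product using (Σ; ∃; ∃-syntax; _×_; _,_)
open import Relation.Nullary using (¬_)
open import Data.Empty using (⊥)
open import Relation.Binary.PropositionalEquality using (_≡_; _≢_)
open import Relation.Unary using (Pred; _∈_; _∉_; _⊆_; _∩_; _∪_; U)

Subset : Set₁
Subset = Pred ℕ 0ℓ

-- ω^{<ω} is represented by List ℕ; s ⁀ n is s ++ [ n ].
Seq : Set
Seq = List ℕ

_⁀_ : Seq → ℕ → Seq
s ⁀ n = s ++ [ n ]

Infinite : Subset → Set
Infinite A = ∀ m → ∃[ n ] (m ≤ n × n ∈ A)

Finite : Subset → Set
Finite A = ∃[ N ] (∀ x → x ∈ A → x < N)

record IsTreeFamily (A : Seq → Subset) : Set where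
  field
    root     : ∀ x → x ∈ A []
    infinite : ∀ s → Infinite (A s)
    sub      : ∀ s n x → x ∈ A (s ⁀ n) → x ∈ A s
    cover    : ∀ s x → x ∈ A s → ∃[ n ] (x ∈ A (s ⁀ n))
    disjoint : ∀ s n m x → n ≢ m → x ∈ A (s ⁀ n) → x ∈ A (s ⁀ m) → ⊥
    separate : ∀ n m → n ≢ m → ∃[ s ] ∃[ t ] (s ≢ t × n ∈ A s × m ∈ A t)

module _ (A : Seq → Subset) where

  Big′ : Subset → Set
  Big′ C = Infinite C ×
           (∀ s → Infinite (C ∩ A s) →
                  ∀ m → ∃[ n ] (m ≤ n × Infinite (C ∩ A (s ⁀ n))))

  Big : Subset → Set₁
  Big B = Σ Subset λ C → C ⊆ B × Big′ C

  𝓗 : Pred Subset (lsuc 0ℓ)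
  𝓗 B = ¬ Big B

record IsIdeal {ℓ : Level} (I : Pred Subset ℓ) : Set (lsuc 0ℓ Level.⊔ ℓ) where
  field
    downward : ∀ {B C : Subset} → B ⊆ C → C ∈ I → B ∈ I
    union    : ∀ {B C : Subset} → B ∈ I → C ∈ I → (B ∪ C) ∈ I
    finite   : ∀ {B : Subset} → Finite B → B ∈ I
    proper   : U ∉ I

-- The only nontrivial axiom is closure under unions: a big′ set D ⊆ B ∪ C must make B or C big.
-- Call a node p good if there is an infinitely branching tree of extensions of p along which D ∩ B
-- stays infinite. If the root is good, D ∩ B is big. Otherwise the nodes along which D is infinite
-- and no prefix is good form such a tree for D ∩ C: a bad node has infinitely many bad children,
-- since a node whose D-children beyond some point are all good is good itself (glue their trees),
-- and below a bad node D ∩ C is infinite, since otherwise the D-nodes above it would witness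
-- goodness for D ∩ B. A tree S along which E is infinite yields a big′ subset of E by choosing, at
-- each node u ∈ S, the least element of E ∩ A_u above sum u: below a node outside S only the choices
-- at its finitely many prefixes can occur.
module Submission where

open import Level using (0ℓ; suc; lift; lower)
open import Axiom.ExcludedMiddle using (ExcludedMiddle)
open import Data.Nat using (_≤_; _<_; _+_; _⊔_; _≟_; s≤s)
open import Data.Nat.Properties using (<-cmp; ≤-refl; ≤-trans; ≤-reflexive; <⇒≱; ≰⇒>; m≤m+n; m≤n+m; m≤m⊔n; m≤n⊔m)
open import Data.Nat.Induction using (<-wellFounded)
open import Induction.WellFounded using (Acc; acc)
open import Data.List using ([]; _∷_; _++_)
open import Data.List.Properties using (++-assoc; ++-identityʳ; ++-conicalˡ; ∷-injective; ∷ʳ-injectiveˡ)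
open import Data.List.Reverse using (Reverse; []; _∶_∶ʳ_; reverseView)
open import Data.Nat.ListAction using (sum)
open import Data.Product using (Σ; ∃; ∃-syntax; _×_; _,_; proj₁; proj₂)
open import Data.Sum using (_⊎_; inj₁; inj₂; [_,_])
open import Data.Empty using (⊥-elim)
open import Data.Unit using (⊤; tt)
open import Function using (_∘_; id)
open import Relation.Nullary using (¬_; Dec; yes; no)
open import Relation.Nullary.Decidable using (map′; False; toWitnessFalse; fromWitnessFalse)
open import Relation.Binary.PropositionalEquality using (_≡_; refl; sym; trans; cong; subst)
open import Relation.Binary.Definitions using (tri<; tri≈; tri>)
open import Relation.Unary using (Pred; _∈_; _∉_; _⊆_; _∩_; _∪_; U)

open import Defs

infix 4 _⊑_

_⊑_ : Seq → Seq → Set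
s ⊑ t = ∃[ v ] s ++ v ≡ t

⊑-refl : ∀ {s} → s ⊑ s
⊑-refl {s} = [] , ++-identityʳ s

⊑-trans : ∀ {s t u} → s ⊑ t → t ⊑ u → s ⊑ u
⊑-trans {s} (v , refl) (w , refl) = v ++ w , sym (++-assoc s v w)

⊑-⁀ : ∀ s n → s ⊑ s ⁀ n
⊑-⁀ s n = n ∷ [] , refl

⊑-++ : ∀ s {t u} → t ⊑ u → s ++ t ⊑ s ++ u
⊑-++ s {t} (v , refl) = v , ++-assoc s t v

++∷⇒⁀⊑ : ∀ {s n v t} → s ++ n ∷ v ≡ t → s ⁀ n ⊑ t
++∷⇒⁀⊑ {s} {n} {v} eq = v , trans (++-assoc s (n ∷ []) v) eq

⊑[]⇒≡[] : ∀ {s} → s ⊑ [] → s ≡ []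
⊑[]⇒≡[] {s} (v , eq) = ++-conicalˡ s v eq

⊑⁀⇒≡⊎⊑ : ∀ {p s n} → p ⊑ s ⁀ n → p ≡ s ⁀ n ⊎ p ⊑ s
⊑⁀⇒≡⊎⊑ {p} (v , eq) with reverseView v
... | []            = inj₁ (trans (sym (++-identityʳ p)) eq)
... | v′ ∶ _ ∶ʳ m = inj₂ (v′ , ∷ʳ-injectiveˡ (p ++ v′) _ (trans (++-assoc p v′ (m ∷ [])) eq))

n≤sum-⁀ : ∀ s n → n ≤ sum (s ⁀ n)
n≤sum-⁀ []      n = m≤m+n n 0
n≤sum-⁀ (a ∷ s) n = ≤-trans (n≤sum-⁀ s n) (m≤n+m _ a)

Infinite-mono : ∀ {X Y : Subset} → X ⊆ Y → Infinite X → Infinite Y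
Infinite-mono X⊆Y X-inf m with X-inf m
... | n , m≤n , n∈X = n , m≤n , X⊆Y n∈X

Finite-antimono : ∀ {X Y : Subset} → X ⊆ Y → Finite Y → Finite X
Finite-antimono X⊆Y (N , bound) = N , λ x x∈X → bound x (X⊆Y x∈X)

Finite⇒¬Infinite : ∀ {X : Subset} → Finite X → ¬ Infinite X
Finite⇒¬Infinite (N , bound) X-inf with X-inf N
... | n , N≤n , n∈X = <⇒≱ (bound n n∈X) N≤n

Least : Subset → Subset
Least P x = x ∈ P × (∀ {y} → y < x → y ∉ P)

Least-unique : ∀ {P x y} → Least P x → Least P y → x ≡ y
Least-unique {x = x} {y} (x∈P , x-least) (y∈P , y-least) with <-cmp x y
... | tri< x<y _ _ = ⊥-elim (y-least x<y x∈P)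
... | tri≈ _ x≡y _ = x≡y
... | tri> _ _ y<x = ⊥-elim (x-least y<x y∈P)

Big-mono : ∀ {A X Y} → X ⊆ Y → Big A X → Big A Y
Big-mono X⊆Y (Z , Z⊆X , Z-big′) = Z , X⊆Y ∘ Z⊆X , Z-big′

Finite⇒¬Big : ∀ {A X} → Finite X → ¬ Big A X
Finite⇒¬Big X-fin (Z , Z⊆X , Z-inf , _) = Finite⇒¬Infinite (Finite-antimono Z⊆X X-fin) Z-inf

record IsTree (S : Pred Seq 0ℓ) : Set where
  field
    root          : [] ∈ S
    prefix-closed : ∀ {s t} → s ⊑ t → t ∈ S → s ∈ S
    branching     : ∀ {s} → s ∈ S → Infinite (λ n → s ⁀ n ∈ S)

module Classical (lem : ExcludedMiddle (suc 0ℓ)) where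

  dec : (P : Set) → Dec P
  dec P = map′ lower lift lem

  least-exists : ∀ {P : Subset} {z} → z ∈ P → ∃ (Least P)
  least-exists {P} {z} = go z (<-wellFounded z)
    where
    go : ∀ z → Acc _<_ z → z ∈ P → ∃ (Least P)
    go z (acc smaller) z∈P with dec (∃[ y ] y < z × y ∈ P)
    ... | yes (y , y<z , y∈P) = go y (smaller y<z) y∈P
    ... | no none-below        = z , z∈P , λ y<z y∈P → none-below (_ , y<z , y∈P)

  Least-finite : (P : Subset) → Finite (Least P)
  Least-finite P with dec (∃ (Least P))
  ... | yes (x , x-least) = 1 + x , λ y y-least → s≤s (≤-reflexive (Least-unique y-least x-least))
  ... | no none           = 0 , λ y y-least → ⊥-elim (none (y , y-least))

  ¬Finite⇒Infinite : ∀ {X : Subset} → ¬ Finite X → Infinite X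
  ¬Finite⇒Infinite {X} ¬fin m with dec (∃[ n ] m ≤ n × n ∈ X)
  ... | yes found = found
  ... | no none   = ⊥-elim (¬fin (m , λ x x∈X → ≰⇒> λ m≤x → none (x , m≤x , x∈X)))

  prefixes-Least-finite : (Q : Seq → Subset) (t : Seq) → Finite (λ x → ∃[ u ] u ⊑ t × Least (Q u) x)
  prefixes-Least-finite Q [] with Least-finite (Q [])
  ... | N , bound =
    N , λ { x (u , u⊑[] , x-least) → bound x (subst (λ u → Least (Q u) x) (⊑[]⇒≡[] u⊑[]) x-least) }
  prefixes-Least-finite Q (a ∷ t) with Least-finite (Q []) | prefixes-Least-finite (Q ∘ (a ∷_)) t
  ... | N₀ , bound₀ | N₁ , bound₁ = N₀ ⊔ N₁ , bound
    where
    bound : ∀ x → ∃[ u ] u ⊑ a ∷ t × Least (Q u) x → x < N₀ ⊔ N₁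
    bound x ([] , _ , x-least) = ≤-trans (bound₀ x x-least) (m≤m⊔n N₀ N₁)
    bound x (b ∷ u , (v , eq) , x-least) with ∷-injective eq
    ... | refl , u++v≡t = ≤-trans (bound₁ x (u , (v , u++v≡t) , x-least)) (m≤n⊔m N₀ N₁)

module TreeFamily {A : Seq → Subset} (tf : IsTreeFamily A) where
  open IsTreeFamily tf using (sub; disjoint; infinite) renaming (root to A[]-full)

  A-antitone : ∀ {s t} → s ⊑ t → A t ⊆ A s
  A-antitone {s} (v , refl) = go (reverseView v)
    where
    go : ∀ {v x} → Reverse v → x ∈ A (s ++ v) → x ∈ A s
    go {x = x} [] x∈A = subst (λ w → x ∈ A w) (++-identityʳ s) x∈A
    go {x = x} (v ∶ v-view ∶ʳ n) x∈A =
      go v-view (sub (s ++ v) n x (subst (λ w → x ∈ A w) (sym (++-assoc s v (n ∷ []))) x∈A))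

  comparable : ∀ {x s t} → x ∈ A s → x ∈ A t → s ⊑ t ⊎ t ⊑ s
  comparable {x} {s} {t} x∈As x∈At = go (reverseView s) x∈As
    where
    go : ∀ {s} → Reverse s → x ∈ A s → s ⊑ t ⊎ t ⊑ s
    go [] _ = inj₁ (t , refl)
    go (s ∶ s-view ∶ʳ n) x∈A with go s-view (sub s n x x∈A)
    ... | inj₂ t⊑s            = inj₂ (⊑-trans t⊑s (⊑-⁀ s n))
    ... | inj₁ ([] , s++[]≡t) = inj₂ (n ∷ [] , cong (_⁀ n) (trans (sym s++[]≡t) (++-identityʳ s)))
    ... | inj₁ (m ∷ v , eq) with m ≟ n
    ...   | yes refl = inj₁ (++∷⇒⁀⊑ eq)
    ...   | no m≢n  = ⊥-elim (disjoint s m n x m≢n (A-antitone (++∷⇒⁀⊑ eq) x∈At) x∈A)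

  U-Big : Big A U
  U-Big = U , id , (λ m → m , ≤-refl , tt) ,
          λ s _ m → m , ≤-refl , Infinite-mono (λ x∈A → tt , x∈A) (infinite (s ⁀ m))

  -- A node w of S stands for the sequence s ++ w.
  WitnessTree : Subset → Seq → Set₁
  WitnessTree E s = Σ (Pred Seq 0ℓ) λ S → IsTree S × (∀ {w} → w ∈ S → Infinite (E ∩ A (s ++ w)))

  witnessTree-from-children : ∀ {E s} {P : Subset} → Infinite P →
                              (∀ {n} → n ∈ P → WitnessTree E (s ⁀ n)) → WitnessTree E s
  witnessTree-from-children {E} {s} {P} P-inf child =
    S , record { root = tt ; prefix-closed = closed ; branching = branch } , E-inf
    where
    open IsTree
    subtree : ∀ {n} → n ∈ P → Pred Seq 0ℓ
    subtree p = proj₁ (child p)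
    subtree-isTree : ∀ {n} (p : n ∈ P) → IsTree (subtree p)
    subtree-isTree p = proj₁ (proj₂ (child p))
    subtree-E-inf : ∀ {n w} (p : n ∈ P) → w ∈ subtree p → Infinite (E ∩ A ((s ⁀ n) ++ w))
    subtree-E-inf p = proj₂ (proj₂ (child p))

    S : Pred Seq 0ℓ
    S []      = ⊤
    S (n ∷ w) = Σ (n ∈ P) λ p → w ∈ subtree p

    closed : ∀ {u t} → u ⊑ t → t ∈ S → u ∈ S
    closed {[]}    _ _ = tt
    closed {n ∷ u} {m ∷ t} (v , eq) (p , t∈) with ∷-injective eq
    ... | refl , u++v≡t = p , prefix-closed (subtree-isTree p) (v , u++v≡t) t∈

    branch : ∀ {w} → w ∈ S → Infinite (λ n → w ⁀ n ∈ S)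
    branch {[]} _ m with P-inf m
    ... | n , m≤n , p = n , m≤n , p , root (subtree-isTree p)
    branch {n ∷ w} (p , w∈) m with branching (subtree-isTree p) w∈ m
    ... | k , m≤k , wk∈ = k , m≤k , p , wk∈

    E-inf : ∀ {w} → w ∈ S → Infinite (E ∩ A (s ++ w))
    E-inf {[]} _ with P-inf 0
    ... | n , _ , p rewrite ++-identityʳ s =
      Infinite-mono (λ (x∈E , x∈A) → x∈E , A-antitone (⊑-trans (⊑-⁀ s n) ([] , refl)) x∈A)
                    (subtree-E-inf p (root (subtree-isTree p)))
    E-inf {n ∷ w} (p , w∈) = subst (λ u → Infinite (E ∩ A u)) (++-assoc s (n ∷ []) w) (subtree-E-inf p w∈)

  module _ (lem : ExcludedMiddle (suc 0ℓ)) where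
    open Classical lem

    witnessTree⇒Big : ∀ {E} → WitnessTree E [] → Big A E
    witnessTree⇒Big {E} (S , isTree , E-inf) = F , F⊆E , Infinite-mono proj₁ (F-below root) , F-branching
      where
      open IsTree isTree
      -- The lower bound sum (s ⁀ n) ≥ n makes the elements chosen below the children of s unbounded.
      Candidate : Seq → Subset
      Candidate u x = sum u ≤ x × x ∈ E ∩ A u

      F : Subset
      F x = ∃[ u ] u ∈ S × Least (Candidate u) x

      F⊆E : F ⊆ E
      F⊆E (_ , _ , (_ , x∈E , _) , _) = x∈E

      F-below : ∀ {s} → s ∈ S → Infinite (F ∩ A s)
      F-below {s} s∈S m with branching s∈S m
      ... | n , m≤n , sn∈S with least-exists {Candidate (s ⁀ n)} (proj₂ (E-inf sn∈S (sum (s ⁀ n))))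
      ... | x , x-least@((sum≤x , _ , x∈Asn) , _) =
        x , ≤-trans m≤n (≤-trans (n≤sum-⁀ s n) sum≤x) , (s ⁀ n , sn∈S , x-least) , sub s n x x∈Asn

      F-∉S-finite : ∀ {t} → t ∉ S → Finite (F ∩ A t)
      F-∉S-finite {t} t∉S = Finite-antimono toPrefix (prefixes-Least-finite Candidate t)
        where
        toPrefix : F ∩ A t ⊆ (λ x → ∃[ u ] u ⊑ t × Least (Candidate u) x)
        toPrefix ((u , u∈S , x-least@((_ , _ , x∈Au) , _)) , x∈At) with comparable x∈Au x∈At
        ... | inj₁ u⊑t = u , u⊑t , x-least
        ... | inj₂ t⊑u = ⊥-elim (t∉S (prefix-closed t⊑u u∈S))

      F-branching : ∀ t → Infinite (F ∩ A t) → Infinite (λ n → Infinite (F ∩ A (t ⁀ n)))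
      F-branching t F∩At-inf with dec (t ∈ S)
      ... | no t∉S  = ⊥-elim (Finite⇒¬Infinite (F-∉S-finite t∉S) F∩At-inf)
      ... | yes t∈S = Infinite-mono F-below (branching t∈S)

    module Dichotomy {B C D : Subset} (D⊆B∪C : D ⊆ B ∪ C) (D-big′ : Big′ A D) where

      Node : Pred Seq 0ℓ
      Node u = Infinite (D ∩ A u)

      Node-antitone : ∀ {s t} → s ⊑ t → Node t → Node s
      Node-antitone s⊑t = Infinite-mono (λ (x∈D , x∈At) → x∈D , A-antitone s⊑t x∈At)

      Node-branching : ∀ {u} → Node u → Infinite (λ n → Node (u ⁀ n))
      Node-branching {u} = proj₂ D-big′ u

      Good : Seq → Set₁
      Good = WitnessTree (D ∩ B)

      -- ¬ Good p lives in Set₁; Bad p is the same proposition in Set, so that bad nodes form a Pred Seq 0ℓ.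
      Bad : Pred Seq 0ℓ
      Bad p = False (lem {Good p})

      C-finite⇒Good : ∀ {w} → Node w → Finite ((D ∩ C) ∩ A w) → Good w
      C-finite⇒Good {w} w-node (N , bound) = (λ v → Node (w ++ v)) , isTree , B-inf
        where
        isTree : IsTree (λ v → Node (w ++ v))
        isTree = record
          { root          = subst Node (sym (++-identityʳ w)) w-node
          ; prefix-closed = λ u⊑t → Node-antitone (⊑-++ w u⊑t)
          ; branching     = λ {v} wv-node →
              Infinite-mono (λ {n} → subst Node (++-assoc w v (n ∷ []))) (Node-branching wv-node)
          }
        B-inf : ∀ {v} → Node (w ++ v) → Infinite ((D ∩ B) ∩ A (w ++ v))
        B-inf {v} wv-node m with wv-node (m ⊔ N)
        ... | x , m⊔N≤x , x∈D , x∈A with D⊆B∪C x∈D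
        ... | inj₁ x∈B = x , ≤-trans (m≤m⊔n m N) m⊔N≤x , (x∈D , x∈B) , x∈A
        ... | inj₂ x∈C =
          ⊥-elim (<⇒≱ (bound x ((x∈D , x∈C) , A-antitone (v , refl) x∈A)) (≤-trans (m≤n⊔m m N) m⊔N≤x))

      Bad⇒C-infinite : ∀ {w} → Node w → w ∈ Bad → Infinite ((D ∩ C) ∩ A w)
      Bad⇒C-infinite w-node w-bad = ¬Finite⇒Infinite (toWitnessFalse w-bad ∘ C-finite⇒Good w-node)

      Bad-branching : ∀ {w} → Node w → w ∈ Bad → Infinite (λ n → Node (w ⁀ n) × w ⁀ n ∈ Bad)
      Bad-branching {w} w-node w-bad = ¬Finite⇒Infinite λ (m , bound) →
        toWitnessFalse w-bad (witnessTree-from-children (late-children m) (late-good m bound))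
        where
        late-children : ∀ m → Infinite (λ n → m ≤ n × Node (w ⁀ n))
        late-children m k with Node-branching w-node (k ⊔ m)
        ... | n , k⊔m≤n , wn-node =
          n , ≤-trans (m≤m⊔n k m) k⊔m≤n , ≤-trans (m≤n⊔m k m) k⊔m≤n , wn-node
        late-good : ∀ m → (∀ n → Node (w ⁀ n) × w ⁀ n ∈ Bad → n < m) →
                    ∀ {n} → m ≤ n × Node (w ⁀ n) → Good (w ⁀ n)
        late-good m bound {n} (m≤n , wn-node) with lem {Good (w ⁀ n)}
        ... | yes good = good
        ... | no ¬good = ⊥-elim (<⇒≱ (bound n (wn-node , fromWitnessFalse ¬good)) m≤n)

      Safe : Pred Seq 0ℓ
      Safe w = Node w × (∀ {p} → p ⊑ w → p ∈ Bad)

      Safe-isTree : [] ∈ Bad → IsTree Safe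
      Safe-isTree []-bad = record { root = root ; prefix-closed = closed ; branching = branch }
        where
        root : [] ∈ Safe
        root = Infinite-mono (λ x∈D → x∈D , A[]-full _) (proj₁ D-big′) ,
               λ p⊑[] → subst Bad (sym (⊑[]⇒≡[] p⊑[])) []-bad
        closed : ∀ {s t} → s ⊑ t → t ∈ Safe → s ∈ Safe
        closed s⊑t (t-node , t-bad) = Node-antitone s⊑t t-node , λ p⊑s → t-bad (⊑-trans p⊑s s⊑t)
        branch : ∀ {w} → w ∈ Safe → Infinite (λ n → w ⁀ n ∈ Safe)
        branch {w} (w-node , w-bad) = Infinite-mono extend (Bad-branching w-node (w-bad ⊑-refl))
          where
          extend : ∀ {n} → Node (w ⁀ n) × w ⁀ n ∈ Bad → w ⁀ n ∈ Safe
          extend (wn-node , wn-bad) = wn-node ,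
            λ p⊑wn → [ (λ p≡wn → subst Bad (sym p≡wn) wn-bad) , w-bad ] (⊑⁀⇒≡⊎⊑ p⊑wn)

      Big-B⊎Big-C : Big A B ⊎ Big A C
      Big-B⊎Big-C with lem {Good []}
      ... | yes good = inj₁ (Big-mono proj₂ (witnessTree⇒Big good))
      ... | no ¬good =
        inj₂ (Big-mono proj₂ (witnessTree⇒Big (Safe , Safe-isTree (fromWitnessFalse ¬good) , C-inf)))
        where
        C-inf : ∀ {w} → w ∈ Safe → Infinite ((D ∩ C) ∩ A w)
        C-inf (w-node , w-bad) = Bad⇒C-infinite w-node (w-bad ⊑-refl)

    Big-∪⁻ : ∀ {B C} → Big A (B ∪ C) → Big A B ⊎ Big A C
    Big-∪⁻ (D , D⊆B∪C , D-big′) = Dichotomy.Big-B⊎Big-C D⊆B∪C D-big′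

proposition1p3 : ExcludedMiddle (suc 0ℓ) → (A : Seq → Subset) → IsTreeFamily A → IsIdeal (𝓗 A)
proposition1p3 lem A tf = record
  { downward = λ B⊆C C∈𝓗 → C∈𝓗 ∘ Big-mono B⊆C
  ; union    = λ B∈𝓗 C∈𝓗 → [ B∈𝓗 , C∈𝓗 ] ∘ Big-∪⁻ lem
  ; finite   = Finite⇒¬Big
  ; proper   = λ U∈𝓗 → U∈𝓗 U-Big
  }
  where open TreeFamily tf
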